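{- Let $a\le b$ be integers, let $L=b-a$, and let $p$ be a real polynomial of degree $d$ with $L\ge 100d^2$. Then for every integer $t\in[a,b]$, $$|p(t)|^2\le 100\,d^2\,\frac{\sum_{s\in\{a,a+1,\dots,b\}}p(s)^2}{L}.$$ -}

module Defs where

open import Level using (0ℓ)
open import Data.Nat as ℕ using (ℕ; zero; suc)
open import Data.Integer as ℤ using (ℤ; +_; -[1+_])
open import Data.Vec using (Vec; []; _∷_)
open import Data.Product using (Σ; _×_; ∃)
open import Relation.Binary.PropositionalEquality using (_≡_)
open import Relation.Nullary using (¬_)
import Data.Sum

-- The real numbers, given axiomatically as a complete ordered field
-- (this characterises ℝ up to isomorphism).  Division is made total by
-- the usual convention 0⁻¹ = 0; only x ≢ 0 → x * x⁻¹ ≡ 1 is asserted.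
record RealField : Set₁ where
  infixl 6 _+_
  infixl 7 _*_
  infix 4 _≤_
  field
    ℝ : Set
    0# 1# : ℝ
    _+_ _*_ : ℝ → ℝ → ℝ
    -_ : ℝ → ℝ
    _⁻¹ : ℝ → ℝ
    _≤_ : ℝ → ℝ → Set
    +-assoc : ∀ x y z → (x + y) + z ≡ x + (y + z)
    +-comm : ∀ x y → x + y ≡ y + x
    +-identityˡ : ∀ x → 0# + x ≡ x
    -‿inverseˡ : ∀ x → (- x) + x ≡ 0#
    *-assoc : ∀ x y z → (x * y) * z ≡ x * (y * z)
    *-comm : ∀ x y → x * y ≡ y * x
    *-identityˡ : ∀ x → 1# * x ≡ x
    distribˡ : ∀ x y z → x * (y + z) ≡ x * y + x * z
    0≢1 : ¬ (0# ≡ 1#)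
    ⁻¹-inverse : ∀ x → ¬ (x ≡ 0#) → x * (x ⁻¹) ≡ 1#
    0⁻¹ : 0# ⁻¹ ≡ 0#
    ≤-refl : ∀ x → x ≤ x
    ≤-trans : ∀ {x y z} → x ≤ y → y ≤ z → x ≤ z
    ≤-antisym : ∀ {x y} → x ≤ y → y ≤ x → x ≡ y
    ≤-total : ∀ x y → (x ≤ y) Data.Sum.⊎ (y ≤ x)
    +-mono-≤ : ∀ {x y} z → x ≤ y → x + z ≤ y + z
    *-nonneg : ∀ {x y} → 0# ≤ x → 0# ≤ y → 0# ≤ x * y
    sup : (P : ℝ → Set) → ∃ P → (∃ λ u → ∀ x → P x → x ≤ u) →
          ∃ λ s → (∀ x → P x → x ≤ s) × (∀ u → (∀ x → P x → x ≤ u) → s ≤ u)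

  fromℕ : ℕ → ℝ
  fromℕ zero = 0#
  fromℕ (suc n) = 1# + fromℕ n

  fromℤ : ℤ → ℝ
  fromℤ (+ n) = fromℕ n
  fromℤ -[1+ n ] = - fromℕ (suc n)

  -- polynomial with coefficient list c₀, c₁, …, evaluated by Horner's rule
  eval : ∀ {n} → Vec ℝ n → ℝ → ℝ
  eval [] x = 0#
  eval (c ∷ cs) x = c + x * eval cs x

  lead : ∀ {d} → Vec ℝ (suc d) → ℝ
  lead (c ∷ []) = c
  lead (c ∷ cs@(_ ∷ _)) = lead cs

  sumTo : ℕ → (ℕ → ℝ) → ℝ
  sumTo zero f = f zero
  sumTo (suc n) f = sumTo n f + f (suc n)

{-# OPTIONS --safe #-}
-- On one side of t, say the right (otherwise reflect p),
-- there are n + 1 ≥ L/2 integer points t + 1, …, t + n + 1 of [a, b].  Put x = t − d, D = n − d and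
--   G(y) = ∏_{j<d} (y − (x + j)) · ∏_{j=1}^{d+1} (x + n + j − y),   W = Δ^{d+1} G,
-- so that deg G = 2d + 1 and deg W ≤ d.  Summing by parts d + 1 times, the zeros of G kill every
-- boundary term but one: Σ_s W(x + s) f(t + 1 + s) = −G(t) f(t) for every f of degree ≤ d, and in
-- particular for f = W(· − d − 1).  Cauchy–Schwarz then gives
--   G(t) p(t)² ≤ −W(x − 1) Σ_s p(t + 1 + s)²,
-- where G(t) = d! Q and −W(x − 1) = d! (P − Q) with Q = (D + 1)⋯(D + d + 1), P = (n + 2)⋯(n + d + 2).
-- Finally (P − Q)/Q ≤ (d + 1)²/(D − (d + 1)²) ≤ 4 (d + 1)²/L ≤ 100 d²/L because the window is long.

module Submission where

open import Defs
open import Level using (0ℓ)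
open import Algebra.Bundles using (CommutativeRing)
open import Algebra.Solver.Ring.AlmostCommutativeRing
  using (AlmostCommutativeRing; fromCommutativeRing; _-Raw-AlmostCommutative⟶_)
open import Data.Empty using (⊥-elim)
open import Data.Integer as ℤ using (ℤ; +_; -[1+_])
import Data.Integer.Properties as ℤP
open import Data.Maybe using (Maybe; just; nothing)
open import Data.Nat as ℕ using (ℕ; zero; suc; z≤n; s≤s; _∸_; _!)
open import Data.Nat.Combinatorics.Base using (_P′_)
open import Data.Nat.Combinatorics.Specification using (nP′n≡n!)
import Data.Nat.Properties as ℕP
open import Data.Nat.Tactic.RingSolver using (solve-∀)
open import Data.Product using (Σ; _×_; _,_; proj₁; proj₂)
open import Data.Sum using (_⊎_; inj₁; inj₂)
open import Data.Vec using (Vec; []; _∷_)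
open import Function using (_∘_)
open import Relation.Binary.Bundles using (Poset)
import Relation.Binary.Reasoning.PartialOrder
open import Relation.Binary.Structures using (IsPreorder)
open import Relation.Binary.PropositionalEquality
open import Relation.Nullary using (¬_; yes; no; contradiction)

module RisingFactorials where
  open import Data.Nat using (_+_; _*_; _≤_; _<_)
  open ℕP using (≤-refl; ≤-reflexive; module ≤-Reasoning)

  rising : ℕ → ℕ → ℕ
  rising D zero    = 1
  rising D (suc k) = rising D k * (D + suc k)

  rising-pos : ∀ D k → 0 < rising D k
  rising-pos D zero    = s≤s z≤n
  rising-pos D (suc k) = ℕP.*-mono-< (rising-pos D k) (ℕP.<-≤-trans (s≤s z≤n) (ℕP.m≤n+m (suc k) D))

  rising-mono-≤ : ∀ {D E} k → D ≤ E → rising D k ≤ rising E k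
  rising-mono-≤ zero    D≤E = ≤-refl
  rising-mono-≤ (suc k) D≤E = ℕP.*-mono-≤ (rising-mono-≤ k D≤E) (ℕP.+-monoˡ-≤ (suc k) D≤E)

  rising-mono-< : ∀ {D E} k → D < E → rising D (suc k) < rising E (suc k)
  rising-mono-< {D} {E} k D<E = ℕP.≤-<-trans
    (ℕP.*-monoˡ-≤ (D + suc k) (rising-mono-≤ k (ℕP.<⇒≤ D<E)))
    (ℕP.*-monoʳ-< (rising E k) {{ℕ.>-nonZero (rising-pos E k)}} (ℕP.+-monoˡ-< (suc k) D<E))

  private
    cross-≤ : ∀ {y e} m → y ≤ e → y * (e + m) ≤ e * (y + m)
    cross-≤ {y} {e} m y≤e = begin
      y * (e + m)   ≡⟨ ℕP.*-distribˡ-+ y e m ⟩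
      y * e + y * m ≤⟨ ℕP.+-monoʳ-≤ (y * e) (ℕP.*-monoˡ-≤ m y≤e) ⟩
      y * e + e * m ≡⟨ cong (_+ e * m) (ℕP.*-comm y e) ⟩
      e * y + e * m ≡⟨ ℕP.*-distribˡ-+ e y m ⟨
      e * (y + m)   ∎
      where open ≤-Reasoning

  -- Each factor (D + m + j)/(D + j) is at most (X + j m)/(X + (j - 1) m), and the product telescopes.
  rising-ratio : ∀ D m k X → X + k * m ≤ D → rising (D + m) k * X ≤ rising D k * (X + k * m)
  rising-ratio D m zero    X _ = ≤-reflexive (cong (_+ 0) (sym (ℕP.+-identityʳ X)))
  rising-ratio D m (suc k) X h = begin
    rising (D + m) k * (D + m + suc k) * X     ≡⟨ regroup (rising (D + m) k) D m k X ⟩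
    rising (D + m) k * X * (E + m)             ≤⟨ ℕP.*-monoˡ-≤ (E + m) (rising-ratio D m k X Y≤D) ⟩
    rising D k * Y * (E + m)                   ≡⟨ ℕP.*-assoc (rising D k) Y (E + m) ⟩
    rising D k * (Y * (E + m))                 ≤⟨ ℕP.*-monoʳ-≤ (rising D k) (cross-≤ m Y≤E) ⟩
    rising D k * (E * (Y + m))                 ≡⟨ expand (rising D k) D m k X ⟩
    rising D k * (D + suc k) * (X + suc k * m) ∎
    where
    open ≤-Reasoning
    E Y : ℕ
    E = D + suc k
    Y = X + k * m
    regroup : ∀ r D m k X → r * (D + m + suc k) * X ≡ r * X * (D + suc k + m)
    regroup = solve-∀
    expand : ∀ r D m k X → r * ((D + suc k) * (X + k * m + m)) ≡ r * (D + suc k) * (X + suc k * m)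
    expand = solve-∀
    Y≤D : Y ≤ D
    Y≤D = ℕP.≤-trans (ℕP.m≤m+n Y m)
      (ℕP.≤-trans (ℕP.≤-reflexive (trans (ℕP.+-assoc X (k * m) m) (cong (_+_ X) (ℕP.+-comm (k * m) m)))) h)
    Y≤E : Y ≤ E
    Y≤E = ℕP.≤-trans Y≤D (ℕP.m≤m+n D (suc k))

  rising-gap-bound : ∀ D m L → L + 4 * (m * m) + 4 * m ≤ 4 * (D + m) →
                     (rising (D + m) m ∸ rising D m) * L ≤ 4 * (m * m) * rising D m
  rising-gap-bound D m L h = begin
    (P ∸ Q) * L         ≤⟨ ℕP.*-monoʳ-≤ (P ∸ Q) L≤4X ⟩
    (P ∸ Q) * (4 * X)   ≡⟨ ℕP.*-comm (P ∸ Q) (4 * X) ⟩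
    4 * X * (P ∸ Q)     ≡⟨ ℕP.*-assoc 4 X (P ∸ Q) ⟩
    4 * (X * (P ∸ Q))   ≡⟨ cong (4 *_) (ℕP.*-comm X (P ∸ Q)) ⟩
    4 * ((P ∸ Q) * X)   ≤⟨ ℕP.*-monoʳ-≤ 4 gap ⟩
    4 * (Q * (m * m))   ≡⟨ cong (4 *_) (ℕP.*-comm Q (m * m)) ⟩
    4 * (m * m * Q)     ≡⟨ ℕP.*-assoc 4 (m * m) Q ⟨
    4 * (m * m) * Q     ∎
    where
    open ≤-Reasoning
    P Q : ℕ
    P = rising (D + m) m
    Q = rising D m
    L+4mm≤4D : L + 4 * (m * m) ≤ 4 * D
    L+4mm≤4D = ℕP.+-cancelʳ-≤ (4 * m) _ _ (ℕP.≤-trans h (ℕP.≤-reflexive (ℕP.*-distribˡ-+ 4 D m)))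
    mm≤D : m * m ≤ D
    mm≤D = ℕP.*-cancelˡ-≤ 4 (ℕP.≤-trans (ℕP.m≤n+m (4 * (m * m)) L) L+4mm≤4D)
    X : ℕ
    X = D ∸ m * m
    X+mm≡D : X + m * m ≡ D
    X+mm≡D = ℕP.m∸n+n≡m mm≤D
    L≤4X : L ≤ 4 * X
    L≤4X = ℕP.+-cancelʳ-≤ (4 * (m * m)) L (4 * X)
      (ℕP.≤-trans L+4mm≤4D (ℕP.≤-reflexive (trans (cong (4 *_) (sym X+mm≡D)) (ℕP.*-distribˡ-+ 4 X (m * m)))))
    gap : (P ∸ Q) * X ≤ Q * (m * m)
    gap = begin
      (P ∸ Q) * X                 ≡⟨ ℕP.*-distribʳ-∸ X P Q ⟩
      P * X ∸ Q * X               ≤⟨ ℕP.∸-monoˡ-≤ (Q * X) (rising-ratio D m m X (ℕP.≤-reflexive X+mm≡D)) ⟩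
      Q * (X + m * m) ∸ Q * X     ≡⟨ cong (_∸ Q * X) (ℕP.*-distribˡ-+ Q X (m * m)) ⟩
      Q * X + Q * (m * m) ∸ Q * X ≡⟨ ℕP.m+n∸m≡n (Q * X) (Q * (m * m)) ⟩
      Q * (m * m)                 ∎

  private
    ≤-by-slack : ∀ {a b} c → a + c ≡ b → a ≤ b
    ≤-by-slack {a} c refl = ℕP.m≤m+n a c

  4[1+d]²+4[1+d]≤100d² : ∀ d → 1 ≤ d → 4 * (suc d * suc d) + 4 * suc d ≤ 100 * d * d
  4[1+d]²+4[1+d]≤100d² (suc e) _ = ≤-by-slack (96 * e * e + 180 * e + 76) (slack e)
    where
    slack : ∀ e → 4 * (suc (suc e) * suc (suc e)) + 4 * suc (suc e) + (96 * e * e + 180 * e + 76)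
                  ≡ 100 * suc e * suc e
    slack = solve-∀

  window-gap-bound : ∀ d n L → 1 ≤ d → 100 * d * d ≤ L → L ≤ 2 * suc n →
    Σ ℕ λ D → D + d ≡ n × (rising (suc (D + d)) (suc d) ∸ rising D (suc d)) * L ≤ 100 * d * d * rising D (suc d)
  window-gap-bound d n L 1≤d 100dd≤L L≤2M = D , D+d≡n , subst Bound (ℕP.+-suc D d) bound
    where
    m : ℕ
    m = suc d
    arith : L + 4 * (m * m) + 4 * m ≤ 4 * suc n
    arith = begin
      L + 4 * (m * m) + 4 * m   ≡⟨ ℕP.+-assoc L _ _ ⟩
      L + (4 * (m * m) + 4 * m) ≤⟨ ℕP.+-monoʳ-≤ L (ℕP.≤-trans (4[1+d]²+4[1+d]≤100d² d 1≤d) 100dd≤L) ⟩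
      L + L                     ≤⟨ ℕP.+-mono-≤ L≤2M L≤2M ⟩
      2 * suc n + 2 * suc n     ≡⟨ ℕP.*-distribʳ-+ (suc n) 2 2 ⟨
      4 * suc n                 ∎
      where open ≤-Reasoning
    d≤n : d ≤ n
    d≤n = ℕP.≤-pred (ℕP.*-cancelˡ-≤ 4 (ℕP.≤-trans (ℕP.m≤n+m (4 * m) _) arith))
    D : ℕ
    D = n ∸ d
    D+d≡n : D + d ≡ n
    D+d≡n = ℕP.m∸n+n≡m d≤n
    M≡D+m : suc n ≡ D + m
    M≡D+m = trans (cong suc (sym D+d≡n)) (sym (ℕP.+-suc D d))
    Bound : ℕ → Set
    Bound M = (rising M m ∸ rising D m) * L ≤ 100 * d * d * rising D m
    bound : Bound (D + m)
    bound = ℕP.≤-trans (rising-gap-bound D m L (subst (λ M → L + 4 * (m * m) + 4 * m ≤ 4 * M) M≡D+m arith))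
      (ℕP.*-monoˡ-≤ (rising D m) (ℕP.≤-trans (ℕP.m≤m+n _ (4 * m)) (4[1+d]²+4[1+d]≤100d² d 1≤d)))

module IntegerInterval where
  open import Data.Nat using (_+_; _*_; _≤_; _<_)
  open import Data.Integer.Tactic.RingSolver as ℤ-Solver using ()

  longer-side : ∀ {i L} → i ≤ L → 0 < L →
    (Σ ℕ λ n → suc (i + n) ≡ L × L ≤ 2 * suc n) ⊎ (Σ ℕ λ n → suc n ≡ i × L ≤ 2 * suc n)
  longer-side {i} {L} i≤L 0<L = by-comparison i (L ∸ i) (ℕP.m+[n∸m]≡n i≤L)
    where
    double : ∀ n → n + n ≡ 2 * n
    double n = cong (_+_ n) (sym (ℕP.+-identityʳ n))
    by-comparison : ∀ i r → i + r ≡ L →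
      (Σ ℕ λ n → suc (i + n) ≡ L × L ≤ 2 * suc n) ⊎ (Σ ℕ λ n → suc n ≡ i × L ≤ 2 * suc n)
    by-comparison i r i+r≡L with ℕP.≤-total i r
    by-comparison zero    zero    refl | _ = contradiction 0<L (λ ())
    by-comparison i       (suc n) refl | inj₁ i≤r =
      inj₁ (n , sym (ℕP.+-suc i n) , ℕP.≤-trans (ℕP.+-monoˡ-≤ (suc n) i≤r) (ℕP.≤-reflexive (double (suc n))))
    by-comparison zero    (suc n) refl | inj₂ ()
    by-comparison (suc n) r       refl | inj₂ r≤i =
      inj₂ (n , refl , ℕP.≤-trans (ℕP.+-monoʳ-≤ (suc n) r≤i) (ℕP.≤-reflexive (double (suc n))))

  offset : ∀ {a t} → a ℤ.≤ t → t ≡ a ℤ.+ + ℤ.∣ t ℤ.- a ∣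
  offset {a} {t} a≤t = begin
    t                         ≡⟨ a+[t-a]≡t a t ⟨
    a ℤ.+ (t ℤ.- a)           ≡⟨ cong (ℤ._+_ a) (ℤP.0≤i⇒+∣i∣≡i (ℤP.i≤j⇒0≤j-i a≤t)) ⟨
    a ℤ.+ + ℤ.∣ t ℤ.- a ∣     ∎
    where
    open ≡-Reasoning
    a+[t-a]≡t : ∀ a t → a ℤ.+ (t ℤ.- a) ≡ t
    a+[t-a]≡t = ℤ-Solver.solve-∀

  offset-mono : ∀ {a t b} → a ℤ.≤ t → t ℤ.≤ b → ℤ.∣ t ℤ.- a ∣ ℕ.≤ ℤ.∣ b ℤ.- a ∣
  offset-mono {a} a≤t t≤b = ℤP.drop‿+≤+ (subst₂ ℤ._≤_
    (sym (ℤP.0≤i⇒+∣i∣≡i (ℤP.i≤j⇒0≤j-i a≤t)))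
    (sym (ℤP.0≤i⇒+∣i∣≡i (ℤP.i≤j⇒0≤j-i (ℤP.≤-trans a≤t t≤b))))
    (ℤP.+-monoˡ-≤ (ℤ.- a) t≤b))

module Real (R : RealField) where
  open RealField R
  open RisingFactorials

  infixl 6 _−_
  _−_ : ℝ → ℝ → ℝ
  x − y = x + (- y)

  private
    +-identityʳ : ∀ x → x + 0# ≡ x
    +-identityʳ x = trans (+-comm x 0#) (+-identityˡ x)

    -‿inverseʳ : ∀ x → x + (- x) ≡ 0#
    -‿inverseʳ x = trans (+-comm x (- x)) (-‿inverseˡ x)

    *-identityʳ : ∀ x → x * 1# ≡ x
    *-identityʳ x = trans (*-comm x 1#) (*-identityˡ x)

    distribʳ : ∀ x y z → (y + z) * x ≡ y * x + z * x
    distribʳ x y z = trans (*-comm (y + z) x) (trans (distribˡ x y z) (cong₂ _+_ (*-comm x y) (*-comm x z)))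

  commutativeRing : CommutativeRing 0ℓ 0ℓ
  commutativeRing = record
    { Carrier = ℝ ; _≈_ = _≡_ ; _+_ = _+_ ; _*_ = _*_ ; -_ = -_ ; 0# = 0# ; 1# = 1#
    ; isCommutativeRing = record
      { isRing = record
        { +-isAbelianGroup = record
          { isGroup = record
            { isMonoid = record
              { isSemigroup = record
                { isMagma = record { isEquivalence = isEquivalence ; ∙-cong = cong₂ _+_ }
                ; assoc = +-assoc }
              ; identity = +-identityˡ , +-identityʳ }
            ; inverse = -‿inverseˡ , -‿inverseʳ
            ; ⁻¹-cong = cong -_ }
          ; comm = +-comm }
        ; *-cong = cong₂ _*_
        ; *-assoc = *-assoc
        ; *-identity = *-identityˡ , *-identityʳ
        ; distrib = distribˡ , distribʳ }
      ; *-comm = *-comm } }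

  open CommutativeRing commutativeRing using (zeroˡ; zeroʳ; ring)
  open import Algebra.Properties.Ring ring using (-‿distribˡ-*; -‿+-comm; -‿involutive; -0#≈0#)

  fromℕ-+ : ∀ m n → fromℕ (m ℕ.+ n) ≡ fromℕ m + fromℕ n
  fromℕ-+ zero    n = sym (+-identityˡ _)
  fromℕ-+ (suc m) n = trans (cong (_+_ 1#) (fromℕ-+ m n)) (sym (+-assoc _ _ _))

  fromℕ-* : ∀ m n → fromℕ (m ℕ.* n) ≡ fromℕ m * fromℕ n
  fromℕ-* zero    n = sym (zeroˡ _)
  fromℕ-* (suc m) n = trans (fromℕ-+ n (m ℕ.* n))
    (trans (cong₂ _+_ (sym (*-identityˡ _)) (fromℕ-* m n)) (sym (distribʳ _ _ _)))

  fromℕ-∸ : ∀ {m n} → n ℕ.≤ m → fromℕ (m ∸ n) ≡ fromℕ m − fromℕ n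
  fromℕ-∸ {m} {n} n≤m = begin
    fromℕ (m ∸ n)                        ≡⟨ +-identityʳ _ ⟨
    fromℕ (m ∸ n) + 0#                   ≡⟨ cong (_+_ (fromℕ (m ∸ n))) (-‿inverseʳ (fromℕ n)) ⟨
    fromℕ (m ∸ n) + (fromℕ n − fromℕ n)  ≡⟨ +-assoc _ _ _ ⟨
    (fromℕ (m ∸ n) + fromℕ n) − fromℕ n  ≡⟨ cong (_− fromℕ n) (fromℕ-+ (m ∸ n) n) ⟨
    fromℕ (m ∸ n ℕ.+ n) − fromℕ n        ≡⟨ cong (λ k → fromℕ k − fromℕ n) (ℕP.m∸n+n≡m n≤m) ⟩
    fromℕ m − fromℕ n                    ∎
    where open ≡-Reasoning

  fromℤ-neg : ∀ i → fromℤ (ℤ.- i) ≡ - fromℤ i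
  fromℤ-neg (+ zero)  = sym -0#≈0#
  fromℤ-neg (+ suc n) = refl
  fromℤ-neg -[1+ n ]  = sym (-‿involutive _)

  fromℤ-⊖ : ∀ m n → fromℤ (m ℤ.⊖ n) ≡ fromℕ m − fromℕ n
  fromℤ-⊖ m n with ℕP.≤-<-connex n m
  ... | inj₁ n≤m = trans (cong fromℤ (ℤP.⊖-≥ n≤m)) (fromℕ-∸ n≤m)
  ... | inj₂ m<n = begin
    fromℤ (m ℤ.⊖ n)                  ≡⟨ cong fromℤ (ℤP.⊖-< m<n) ⟩
    fromℤ (ℤ.- (+ (n ∸ m)))          ≡⟨ fromℤ-neg (+ (n ∸ m)) ⟩
    - fromℕ (n ∸ m)                  ≡⟨ cong -_ (fromℕ-∸ (ℕP.<⇒≤ m<n)) ⟩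
    - (fromℕ n − fromℕ m)            ≡⟨ -‿+-comm _ _ ⟨
    - fromℕ n + - - fromℕ m          ≡⟨ cong (_+_ (- fromℕ n)) (-‿involutive _) ⟩
    - fromℕ n + fromℕ m              ≡⟨ +-comm _ _ ⟩
    fromℕ m − fromℕ n                ∎
    where open ≡-Reasoning

  fromℤ-+ : ∀ i j → fromℤ (i ℤ.+ j) ≡ fromℤ i + fromℤ j
  fromℤ-+ -[1+ m ] -[1+ n ] = trans (cong -_ (trans (cong (fromℕ ∘ suc) (sym (ℕP.+-suc m n))) (fromℕ-+ (suc m) (suc n))))
                                     (sym (-‿+-comm _ _))
  fromℤ-+ -[1+ m ] (+ n)    = trans (fromℤ-⊖ n (suc m)) (+-comm _ _)
  fromℤ-+ (+ m)    -[1+ n ] = fromℤ-⊖ m (suc n)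
  fromℤ-+ (+ m)    (+ n)    = fromℕ-+ m n

  private
    fromℤ-*-pos : ∀ i n → fromℤ (i ℤ.* + n) ≡ fromℤ i * fromℕ n
    fromℤ-*-pos (+ m)    n = trans (cong fromℤ (sym (ℤP.pos-* m n))) (fromℕ-* m n)
    fromℤ-*-pos -[1+ m ] n = begin
      fromℤ (ℤ.- (+ suc m) ℤ.* + n)   ≡⟨ cong fromℤ (ℤP.neg-distribˡ-* (+ suc m) (+ n)) ⟨
      fromℤ (ℤ.- (+ suc m ℤ.* + n))   ≡⟨ fromℤ-neg (+ suc m ℤ.* + n) ⟩
      - fromℤ (+ suc m ℤ.* + n)       ≡⟨ cong -_ (fromℤ-*-pos (+ suc m) n) ⟩
      - (fromℕ (suc m) * fromℕ n)     ≡⟨ -‿distribˡ-* _ _ ⟩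
      - fromℕ (suc m) * fromℕ n       ∎
      where open ≡-Reasoning

  fromℤ-* : ∀ i j → fromℤ (i ℤ.* j) ≡ fromℤ i * fromℤ j
  fromℤ-* i (+ n)    = fromℤ-*-pos i n
  fromℤ-* i -[1+ n ] = begin
    fromℤ (i ℤ.* ℤ.- (+ suc n))      ≡⟨ cong fromℤ (ℤP.neg-distribʳ-* i (+ suc n)) ⟨
    fromℤ (ℤ.- (i ℤ.* + suc n))      ≡⟨ fromℤ-neg (i ℤ.* + suc n) ⟩
    - fromℤ (i ℤ.* + suc n)          ≡⟨ cong -_ (fromℤ-*-pos i (suc n)) ⟩
    - (fromℤ i * fromℕ (suc n))      ≡⟨ trans (cong -_ (*-comm _ _)) (trans (-‿distribˡ-* _ _) (*-comm _ _)) ⟩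
    fromℤ i * - fromℕ (suc n)        ∎
    where open ≡-Reasoning

  -- An embedding ℤ → ℝ that sends + 1 to 1# on the nose, so that the solver's constant 1 is 1#.
  private
    fromℕ′ : ℕ → ℝ
    fromℕ′ zero          = 0#
    fromℕ′ (suc zero)    = 1#
    fromℕ′ (suc (suc n)) = 1# + fromℕ′ (suc n)

    fromℕ′≡fromℕ : ∀ n → fromℕ′ n ≡ fromℕ n
    fromℕ′≡fromℕ zero          = refl
    fromℕ′≡fromℕ (suc zero)    = sym (+-identityʳ 1#)
    fromℕ′≡fromℕ (suc (suc n)) = cong (_+_ 1#) (fromℕ′≡fromℕ (suc n))

    fromℤ′ : ℤ → ℝ
    fromℤ′ (+ n)    = fromℕ′ n
    fromℤ′ -[1+ n ] = - fromℕ′ (suc n)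

    fromℤ′≡fromℤ : ∀ i → fromℤ′ i ≡ fromℤ i
    fromℤ′≡fromℤ (+ n)    = fromℕ′≡fromℕ n
    fromℤ′≡fromℤ -[1+ n ] = cong -_ (fromℕ′≡fromℕ (suc n))

    homomorphic₂ : ∀ (_∙_ : ℤ → ℤ → ℤ) (_∘′_ : ℝ → ℝ → ℝ) → (∀ i j → fromℤ (i ∙ j) ≡ fromℤ i ∘′ fromℤ j) →
                   ∀ i j → fromℤ′ (i ∙ j) ≡ fromℤ′ i ∘′ fromℤ′ j
    homomorphic₂ _∙_ _∘′_ hom i j =
      trans (fromℤ′≡fromℤ (i ∙ j)) (trans (hom i j) (sym (cong₂ _∘′_ (fromℤ′≡fromℤ i) (fromℤ′≡fromℤ j))))

    almostCommutativeRing : AlmostCommutativeRing 0ℓ 0ℓ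
    almostCommutativeRing = fromCommutativeRing commutativeRing

    ℤ⟶ℝ : ℤ.+-*-rawRing -Raw-AlmostCommutative⟶ almostCommutativeRing
    ℤ⟶ℝ = record
      { ⟦_⟧    = fromℤ′
      ; +-homo = homomorphic₂ ℤ._+_ _+_ fromℤ-+
      ; *-homo = homomorphic₂ ℤ._*_ _*_ fromℤ-*
      ; -‿homo = λ i → trans (fromℤ′≡fromℤ (ℤ.- i)) (trans (fromℤ-neg i) (sym (cong -_ (fromℤ′≡fromℤ i))))
      ; 0-homo = refl
      ; 1-homo = refl
      }

    ℤ-coefficients≟ : ∀ i j → Maybe (fromℤ′ i ≡ fromℤ′ j)
    ℤ-coefficients≟ i j with i ℤ.≟ j
    ... | yes i≡j = just (cong fromℤ′ i≡j)
    ... | no  _   = nothing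

  open import Algebra.Solver.Ring ℤ.+-*-rawRing almostCommutativeRing ℤ⟶ℝ ℤ-coefficients≟
    using (solve; _:=_; _:+_; _:*_; :-_; _:-_; con)

  ≤-isPreorder : IsPreorder _≡_ _≤_
  ≤-isPreorder = record { isEquivalence = isEquivalence ; reflexive = λ { refl → ≤-refl _ } ; trans = ≤-trans }

  ≤-poset : Poset 0ℓ 0ℓ 0ℓ
  ≤-poset = record { isPartialOrder = record { isPreorder = ≤-isPreorder ; antisym = ≤-antisym } }

  module ≤-Reasoning = Relation.Binary.Reasoning.PartialOrder ≤-poset

  ≤-resp-≡ : ∀ {x y x′ y′} → x ≡ x′ → y ≡ y′ → x ≤ y → x′ ≤ y′
  ≤-resp-≡ refl refl x≤y = x≤y

  +-monoʳ-≤ : ∀ {x y} z → x ≤ y → z + x ≤ z + y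
  +-monoʳ-≤ {x} {y} z x≤y = ≤-resp-≡ (+-comm x z) (+-comm y z) (+-mono-≤ z x≤y)

  x≤y⇒0≤y−x : ∀ {x y} → x ≤ y → 0# ≤ y − x
  x≤y⇒0≤y−x {x} x≤y = ≤-resp-≡ (-‿inverseʳ x) refl (+-mono-≤ (- x) x≤y)

  0≤y−x⇒x≤y : ∀ {x y} → 0# ≤ y − x → x ≤ y
  0≤y−x⇒x≤y {x} {y} 0≤y−x =
    ≤-resp-≡ (+-identityˡ x) (solve 2 (λ x y → y :- x :+ x := y) refl x y) (+-mono-≤ x 0≤y−x)

  x≤0⇒0≤-x : ∀ {x} → x ≤ 0# → 0# ≤ - x
  x≤0⇒0≤-x {x} x≤0 = ≤-resp-≡ (-‿inverseʳ x) (+-identityˡ (- x)) (+-mono-≤ (- x) x≤0)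

  0≤x*x : ∀ x → 0# ≤ x * x
  0≤x*x x with ≤-total 0# x
  ... | inj₁ 0≤x = *-nonneg 0≤x 0≤x
  ... | inj₂ x≤0 = ≤-resp-≡ refl (solve 1 (λ x → (:- x) :* (:- x) := x :* x) refl x)
                     (*-nonneg (x≤0⇒0≤-x x≤0) (x≤0⇒0≤-x x≤0))

  0≤1 : 0# ≤ 1#
  0≤1 = ≤-resp-≡ refl (*-identityˡ 1#) (0≤x*x 1#)

  0≤+ : ∀ {x y} → 0# ≤ x → 0# ≤ y → 0# ≤ x + y
  0≤+ {x} {y} 0≤x 0≤y = ≤-trans 0≤x (≤-resp-≡ (+-identityʳ x) refl (+-monoʳ-≤ x 0≤y))

  *-monoˡ-≤ : ∀ {x y} z → 0# ≤ z → x ≤ y → z * x ≤ z * y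
  *-monoˡ-≤ {x} {y} z 0≤z x≤y = 0≤y−x⇒x≤y
    (≤-resp-≡ refl (solve 3 (λ x y z → z :* (y :- x) := z :* y :- z :* x) refl x y z)
      (*-nonneg 0≤z (x≤y⇒0≤y−x x≤y)))

  *-monoʳ-≤ : ∀ {x y} z → 0# ≤ z → x ≤ y → x * z ≤ y * z
  *-monoʳ-≤ {x} {y} z 0≤z x≤y = ≤-resp-≡ (*-comm z x) (*-comm z y) (*-monoˡ-≤ z 0≤z x≤y)

  0≤fromℕ : ∀ n → 0# ≤ fromℕ n
  0≤fromℕ zero    = ≤-refl 0#
  0≤fromℕ (suc n) = 0≤+ 0≤1 (0≤fromℕ n)

  fromℕ-mono-≤ : ∀ {m n} → m ℕ.≤ n → fromℕ m ≤ fromℕ n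
  fromℕ-mono-≤ {m} {n} m≤n = ≤-resp-≡ (+-identityʳ (fromℕ m))
    (trans (sym (fromℕ-+ m (n ∸ m))) (cong fromℕ (ℕP.m+[n∸m]≡n m≤n)))
    (+-monoʳ-≤ (fromℕ m) (0≤fromℕ (n ∸ m)))

  fromℕ-pos⇒≢0 : ∀ {n} → 0 ℕ.< n → ¬ (fromℕ n ≡ 0#)
  fromℕ-pos⇒≢0 {suc n} _ 1+n≡0 = 0≢1 (≤-antisym 0≤1 1≤0)
    where
    1≤0 : 1# ≤ 0#
    1≤0 = ≤-resp-≡ (+-identityʳ 1#) 1+n≡0 (+-monoʳ-≤ 1# (0≤fromℕ n))

  0≤⁻¹ : ∀ {x} → ¬ (x ≡ 0#) → 0# ≤ x → 0# ≤ x ⁻¹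
  0≤⁻¹ {x} x≢0 0≤x with ≤-total 0# (x ⁻¹)
  ... | inj₁ 0≤x⁻¹ = 0≤x⁻¹
  ... | inj₂ x⁻¹≤0 = ⊥-elim (0≢1 (≤-antisym 0≤1 (≤-resp-≡ (+-identityˡ 1#) (-‿inverseˡ 1#) (+-mono-≤ 1# 0≤-1))))
    where
    0≤-1 : 0# ≤ - 1#
    0≤-1 = ≤-resp-≡ refl (trans (solve 2 (λ x y → x :* (:- y) := :- (x :* y)) refl x (x ⁻¹)) (cong -_ (⁻¹-inverse x x≢0)))
             (*-nonneg 0≤x (x≤0⇒0≤-x x⁻¹≤0))

  *-cancelˡ-≤ : ∀ {x y} z → ¬ (z ≡ 0#) → 0# ≤ z → z * x ≤ z * y → x ≤ y
  *-cancelˡ-≤ {x} {y} z z≢0 0≤z zx≤zy = ≤-resp-≡ (z⁻¹z· x) (z⁻¹z· y) (*-monoˡ-≤ (z ⁻¹) (0≤⁻¹ z≢0 0≤z) zx≤zy)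
    where
    z⁻¹z· : ∀ w → z ⁻¹ * (z * w) ≡ w
    z⁻¹z· w = trans (sym (*-assoc _ _ _)) (trans (cong (_* w) (trans (*-comm _ _) (⁻¹-inverse z z≢0))) (*-identityˡ w))

  fromℕ-*-cancelˡ-≤ : ∀ {x y} n → 0 ℕ.< n → fromℕ n * x ≤ fromℕ n * y → x ≤ y
  fromℕ-*-cancelˡ-≤ n 0<n = *-cancelˡ-≤ (fromℕ n) (fromℕ-pos⇒≢0 0<n) (0≤fromℕ n)

  ≤-*-fromℕ⁻¹ : ∀ {x y} n → 0 ℕ.< n → fromℕ n * x ≤ y → x ≤ y * fromℕ n ⁻¹
  ≤-*-fromℕ⁻¹ {x} {y} n 0<n nx≤y =
    ≤-resp-≡ (trans (*-comm (fromℕ n * x) _) (trans (sym (*-assoc _ _ _)) (trans (cong (_* x) n⁻¹n≡1) (*-identityˡ x)))) refl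
      (*-monoʳ-≤ (fromℕ n ⁻¹) (0≤⁻¹ n≢0 (0≤fromℕ n)) nx≤y)
    where
    n≢0 : ¬ (fromℕ n ≡ 0#)
    n≢0 = fromℕ-pos⇒≢0 0<n
    n⁻¹n≡1 : fromℕ n ⁻¹ * fromℕ n ≡ 1#
    n⁻¹n≡1 = trans (*-comm _ _) (⁻¹-inverse (fromℕ n) n≢0)

  -- Finite differences

  Δ : (ℝ → ℝ) → ℝ → ℝ
  Δ F y = F (1# + y) − F y

  Δ^ : ℕ → (ℝ → ℝ) → ℝ → ℝ
  Δ^ zero    F = F
  Δ^ (suc k) F = Δ (Δ^ k F)

  Δ^-cong : ∀ k {F G} → (∀ y → F y ≡ G y) → ∀ y → Δ^ k F y ≡ Δ^ k G y
  Δ^-cong zero    F≗G y = F≗G y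
  Δ^-cong (suc k) F≗G y = cong₂ _−_ (Δ^-cong k F≗G (1# + y)) (Δ^-cong k F≗G y)

  Δ^-+ : ∀ k F G y → Δ^ k (λ z → F z + G z) y ≡ Δ^ k F y + Δ^ k G y
  Δ^-+ zero    F G y = refl
  Δ^-+ (suc k) F G y = trans (cong₂ _−_ (Δ^-+ k F G (1# + y)) (Δ^-+ k F G y))
    (solve 4 (λ a b c d → (a :+ b) :- (c :+ d) := (a :- c) :+ (b :- d)) refl _ _ _ _)

  Δ^-* : ∀ k c F y → Δ^ k (λ z → c * F z) y ≡ c * Δ^ k F y
  Δ^-* zero    c F y = refl
  Δ^-* (suc k) c F y = trans (cong₂ _−_ (Δ^-* k c F (1# + y)) (Δ^-* k c F y))
    (solve 3 (λ c a b → c :* a :- c :* b := c :* (a :- b)) refl _ _ _)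

  Δ^-translate : ∀ k c F y → Δ^ k (λ z → F (c + z)) y ≡ Δ^ k F (c + y)
  Δ^-translate zero    c F y = refl
  Δ^-translate (suc k) c F y = cong₂ _−_
    (trans (Δ^-translate k c F (1# + y)) (cong (Δ^ k F) (solve 3 (λ c y o → c :+ (o :+ y) := o :+ (c :+ y)) refl c y 1#)))
    (Δ^-translate k c F y)

  Δ^-+ℕ : ∀ a b F y → Δ^ a (Δ^ b F) y ≡ Δ^ (a ℕ.+ b) F y
  Δ^-+ℕ zero    b F y = refl
  Δ^-+ℕ (suc a) b F y = cong₂ _−_ (Δ^-+ℕ a b F (1# + y)) (Δ^-+ℕ a b F y)

  Δ^-Δ : ∀ k F y → Δ^ k (Δ F) y ≡ Δ^ (suc k) F y
  Δ^-Δ k F y = trans (Δ^-+ℕ k 1 F y) (cong (λ j → Δ^ j F y) (ℕP.+-comm k 1))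

  record DegreeBelow (k : ℕ) (F : ℝ → ℝ) : Set where
    constructor degreeBelow
    field Δ^≡0 : ∀ y → Δ^ k F y ≡ 0#
  open DegreeBelow

  DegreeBelow-cong : ∀ {k F G} → (∀ y → F y ≡ G y) → DegreeBelow k F → DegreeBelow k G
  DegreeBelow-cong {k} F≗G dF = degreeBelow λ y → trans (sym (Δ^-cong k F≗G y)) (Δ^≡0 dF y)

  DegreeBelow-suc : ∀ {k F} → DegreeBelow k F → DegreeBelow (suc k) F
  DegreeBelow-suc dF = degreeBelow λ y → trans (cong₂ _−_ (Δ^≡0 dF _) (Δ^≡0 dF y)) (-‿inverseʳ 0#)

  DegreeBelow-Δ : ∀ {k F} → DegreeBelow (suc k) F → DegreeBelow k (Δ F)
  DegreeBelow-Δ {k} {F} dF = degreeBelow λ y → trans (Δ^-Δ k F y) (Δ^≡0 dF y)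

  DegreeBelow-Δ⁻ : ∀ {k F} → DegreeBelow k (Δ F) → DegreeBelow (suc k) F
  DegreeBelow-Δ⁻ {k} {F} dΔF = degreeBelow λ y → trans (sym (Δ^-Δ k F y)) (Δ^≡0 dΔF y)

  DegreeBelow-Δ^ : ∀ {k F} j → DegreeBelow (k ℕ.+ j) F → DegreeBelow k (Δ^ j F)
  DegreeBelow-Δ^ {k} {F} j dF = degreeBelow λ y → trans (Δ^-+ℕ k j F y) (Δ^≡0 dF y)

  DegreeBelow-+ : ∀ {k F G} → DegreeBelow k F → DegreeBelow k G → DegreeBelow k (λ z → F z + G z)
  DegreeBelow-+ {k} {F} {G} dF dG = degreeBelow λ y →
    trans (Δ^-+ k F G y) (trans (cong₂ _+_ (Δ^≡0 dF y) (Δ^≡0 dG y)) (+-identityʳ 0#))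

  DegreeBelow-* : ∀ {k F} c → DegreeBelow k F → DegreeBelow k (λ z → c * F z)
  DegreeBelow-* {k} {F} c dF = degreeBelow λ y → trans (Δ^-* k c F y) (trans (cong (c *_) (Δ^≡0 dF y)) (zeroʳ c))

  DegreeBelow-translate : ∀ {k F} c → DegreeBelow k F → DegreeBelow k (λ z → F (c + z))
  DegreeBelow-translate {k} {F} c dF = degreeBelow λ y → trans (Δ^-translate k c F y) (Δ^≡0 dF _)

  DegreeBelow-const : ∀ k c → DegreeBelow (suc k) (λ _ → c)
  DegreeBelow-const zero    c = degreeBelow λ _ → -‿inverseʳ c
  DegreeBelow-const (suc k) c = DegreeBelow-suc (DegreeBelow-const k c)

  DegreeBelow-x* : ∀ k {F} → DegreeBelow k F → DegreeBelow (suc k) (λ y → y * F y)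
  DegreeBelow-x* zero {F} dF = degreeBelow λ y → begin
    (1# + y) * F (1# + y) − y * F y ≡⟨ cong₂ (λ a b → (1# + y) * a − y * b) (Δ^≡0 dF (1# + y)) (Δ^≡0 dF y) ⟩
    (1# + y) * 0# − y * 0#         ≡⟨ solve 1 (λ y → (con (+ 1) :+ y) :* con (+ 0) :- y :* con (+ 0) := con (+ 0)) refl y ⟩
    0#                              ∎
    where open ≡-Reasoning
  DegreeBelow-x* (suc k) {F} dF = DegreeBelow-Δ⁻ (DegreeBelow-cong product-rule
    (DegreeBelow-+ (DegreeBelow-x* k (DegreeBelow-Δ dF)) (DegreeBelow-translate 1# dF)))
    where
    product-rule : ∀ z → z * Δ F z + F (1# + z) ≡ Δ (λ y → y * F y) z
    product-rule z = solve 3 (λ z a b → z :* (a :- b) :+ a := (con (+ 1) :+ z) :* a :- z :* b) refl z (F (1# + z)) (F z)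

  DegreeBelow-linear* : ∀ {k F} r → DegreeBelow k F → DegreeBelow (suc k) (λ y → (y − r) * F y)
  DegreeBelow-linear* {k} {F} r dF = DegreeBelow-cong
    (λ y → solve 3 (λ y f r → y :* f :+ (:- r) :* f := (y :- r) :* f) refl y (F y) r)
    (DegreeBelow-+ (DegreeBelow-x* k dF) (DegreeBelow-* (- r) (DegreeBelow-suc dF)))

  DegreeBelow-eval : ∀ {n} (c : Vec ℝ n) → DegreeBelow n (eval c)
  DegreeBelow-eval []            = degreeBelow λ _ → refl
  DegreeBelow-eval {suc n} (c ∷ cs) = DegreeBelow-+ (DegreeBelow-const n c) (DegreeBelow-x* n (DegreeBelow-eval cs))

  DegreeBelow-reflect : ∀ k {F} → DegreeBelow k F → DegreeBelow k (λ y → F (- y))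
  DegreeBelow-reflect zero    {F} dF = degreeBelow λ y → Δ^≡0 dF (- y)
  DegreeBelow-reflect (suc k) {F} dF = DegreeBelow-Δ⁻ (DegreeBelow-cong reflected-difference
    (DegreeBelow-* (- 1#) (DegreeBelow-translate 1# (DegreeBelow-reflect k (DegreeBelow-Δ dF)))))
    where
    reflected-difference : ∀ z → - 1# * Δ F (- (1# + z)) ≡ Δ (λ y → F (- y)) z
    reflected-difference z = begin
      - 1# * (F (1# + - (1# + z)) − F (- (1# + z)))
        ≡⟨ cong (λ w → - 1# * (F w − F (- (1# + z)))) (solve 1 (λ z → con (+ 1) :+ (:- (con (+ 1) :+ z)) := :- z) refl z) ⟩
      - 1# * (F (- z) − F (- (1# + z)))
        ≡⟨ solve 2 (λ a b → (:- con (+ 1)) :* (a :- b) := b :- a) refl (F (- z)) (F (- (1# + z))) ⟩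
      F (- (1# + z)) − F (- z) ∎
      where open ≡-Reasoning

  -- Sums and summation by parts

  sumTo-cong : ∀ n {u v : ℕ → ℝ} → (∀ s → s ℕ.≤ n → u s ≡ v s) → sumTo n u ≡ sumTo n v
  sumTo-cong zero    u≗v = u≗v 0 z≤n
  sumTo-cong (suc n) u≗v = cong₂ _+_ (sumTo-cong n (λ s s≤n → u≗v s (ℕP.m≤n⇒m≤1+n s≤n))) (u≗v (suc n) ℕP.≤-refl)

  sumTo-+ : ∀ n (u v : ℕ → ℝ) → sumTo n (λ s → u s + v s) ≡ sumTo n u + sumTo n v
  sumTo-+ zero    u v = refl
  sumTo-+ (suc n) u v = trans (cong (_+ (u (suc n) + v (suc n))) (sumTo-+ n u v))
    (solve 4 (λ a b c d → (a :+ b) :+ (c :+ d) := (a :+ c) :+ (b :+ d)) refl _ _ _ _)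

  sumTo-* : ∀ n c (u : ℕ → ℝ) → sumTo n (λ s → c * u s) ≡ c * sumTo n u
  sumTo-* zero    c u = refl
  sumTo-* (suc n) c u = trans (cong (_+ c * u (suc n)) (sumTo-* n c u)) (sym (distribˡ _ _ _))

  sumTo-0 : ∀ n (u : ℕ → ℝ) → (∀ s → u s ≡ 0#) → sumTo n u ≡ 0#
  sumTo-0 zero    u u≗0 = u≗0 0
  sumTo-0 (suc n) u u≗0 = trans (cong₂ _+_ (sumTo-0 n u u≗0) (u≗0 (suc n))) (+-identityʳ 0#)

  sumTo-nonneg : ∀ n (u : ℕ → ℝ) → (∀ s → 0# ≤ u s) → 0# ≤ sumTo n u
  sumTo-nonneg zero    u 0≤u = 0≤u 0
  sumTo-nonneg (suc n) u 0≤u = 0≤+ (sumTo-nonneg n u 0≤u) (0≤u (suc n))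

  sumTo-suc : ∀ n (u : ℕ → ℝ) → sumTo (suc n) u ≡ u 0 + sumTo n (u ∘ suc)
  sumTo-suc zero    u = refl
  sumTo-suc (suc n) u = trans (cong (_+ u (suc (suc n))) (sumTo-suc n u)) (+-assoc _ _ _)

  sumTo-reverse : ∀ n (u : ℕ → ℝ) → sumTo n (λ s → u (n ∸ s)) ≡ sumTo n u
  sumTo-reverse zero    u = refl
  sumTo-reverse (suc n) u = begin
    sumTo (suc n) (λ s → u (suc n ∸ s))     ≡⟨ cong₂ _+_ (sumTo-cong n (λ s s≤n → cong u (ℕP.+-∸-assoc 1 s≤n)))
                                                          (cong u (ℕP.n∸n≡0 n)) ⟩
    sumTo n (λ s → u (suc (n ∸ s))) + u 0   ≡⟨ cong (_+ u 0) (sumTo-reverse n (u ∘ suc)) ⟩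
    sumTo n (u ∘ suc) + u 0                 ≡⟨ +-comm _ _ ⟩
    u 0 + sumTo n (u ∘ suc)                 ≡⟨ sumTo-suc n u ⟨
    sumTo (suc n) u                         ∎
    where open ≡-Reasoning

  sumTo-mono-upper : ∀ (u : ℕ → ℝ) → (∀ s → 0# ≤ u s) → ∀ {m n} → m ℕ.≤ n → sumTo m u ≤ sumTo n u
  sumTo-mono-upper u 0≤u {m} {zero}  z≤n = ≤-refl _
  sumTo-mono-upper u 0≤u {m} {suc n} m≤1+n with ℕP.m≤n⇒m<n∨m≡n m≤1+n
  ... | inj₁ m<1+n = ≤-trans (sumTo-mono-upper u 0≤u (ℕP.≤-pred m<1+n))
                             (≤-resp-≡ (+-identityʳ _) refl (+-monoʳ-≤ (sumTo n u) (0≤u (suc n))))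
  ... | inj₂ refl  = ≤-refl _

  sumTo-tail-≤ : ∀ (u : ℕ → ℝ) → (∀ s → 0# ≤ u s) → ∀ i n →
                 sumTo n (λ s → u (suc (i ℕ.+ s))) ≤ sumTo (suc (i ℕ.+ n)) u
  sumTo-tail-≤ u 0≤u i zero    = ≤-resp-≡ (+-identityˡ _) refl (+-mono-≤ (u (suc (i ℕ.+ 0))) (sumTo-nonneg (i ℕ.+ 0) u 0≤u))
  sumTo-tail-≤ u 0≤u i (suc n) = ≤-resp-≡ refl (cong (λ k → sumTo k u + u (suc (i ℕ.+ suc n))) (sym (ℕP.+-suc i n)))
    (+-mono-≤ (u (suc (i ℕ.+ suc n))) (sumTo-tail-≤ u 0≤u i n))

  shift : ℕ → ℝ → ℝ
  shift zero    y = y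
  shift (suc k) y = 1# + shift k y

  shift-1+ : ∀ k y → shift k (1# + y) ≡ shift (suc k) y
  shift-1+ zero    y = refl
  shift-1+ (suc k) y = cong (_+_ 1#) (shift-1+ k y)

  shift-shift : ∀ a b y → shift a (shift b y) ≡ shift (a ℕ.+ b) y
  shift-shift zero    b y = refl
  shift-shift (suc a) b y = cong (_+_ 1#) (shift-shift a b y)

  shift≡fromℕ+ : ∀ k y → shift k y ≡ fromℕ k + y
  shift≡fromℕ+ zero    y = sym (+-identityˡ y)
  shift≡fromℕ+ (suc k) y = trans (cong (_+_ 1#) (shift≡fromℕ+ k y)) (sym (+-assoc _ _ _))

  Δ-∘shift : ∀ j h z → Δ (h ∘ shift j) z ≡ Δ h (shift j z)
  Δ-∘shift j h z = cong (λ w → h w − h (shift j z)) (shift-1+ j z)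

  telescope : ∀ n (Φ : ℝ → ℝ) x → sumTo n (λ s → Φ (shift (suc s) x) − Φ (shift s x)) ≡ Φ (shift (suc n) x) − Φ x
  telescope zero    Φ x = refl
  telescope (suc n) Φ x = trans (cong (_+ (Φ (shift (suc (suc n)) x) − Φ (shift (suc n) x))) (telescope n Φ x))
    (solve 3 (λ a b c → (b :- a) :+ (c :- b) := c :- a) refl _ _ _)

  summation-by-parts : ∀ n (g h : ℝ → ℝ) x →
    sumTo n (λ s → Δ g (shift s x) * h (shift (suc s) x))
      ≡ g (shift (suc n) x) * h (shift (suc n) x) − g x * h x − sumTo n (λ s → g (shift s x) * Δ h (shift s x))
  summation-by-parts n g h x = begin
    S                     ≡⟨ solve 2 (λ S T → S := S :+ T :- T) refl S T ⟩
    S + T − T             ≡⟨ cong (_− T) (sumTo-+ n _ _) ⟨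
    sumTo n (λ s → Δ g (shift s x) * h (shift (suc s) x) + g (shift s x) * Δ h (shift s x)) − T
                          ≡⟨ cong (_− T) (sumTo-cong n λ s _ → product-rule (shift s x)) ⟩
    sumTo n (λ s → g (shift (suc s) x) * h (shift (suc s) x) − g (shift s x) * h (shift s x)) − T
                          ≡⟨ cong (_− T) (telescope n (λ z → g z * h z) x) ⟩
    g (shift (suc n) x) * h (shift (suc n) x) − g x * h x − T ∎
    where
    open ≡-Reasoning
    S T : ℝ
    S = sumTo n (λ s → Δ g (shift s x) * h (shift (suc s) x))
    T = sumTo n (λ s → g (shift s x) * Δ h (shift s x))
    product-rule : ∀ z → Δ g z * h (1# + z) + g z * Δ h z ≡ g (1# + z) * h (1# + z) − g z * h z
    product-rule z = solve 4 (λ a b c d → (a :- b) :* c :+ b :* (c :- d) := a :* c :- b :* d) refl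
      (g (1# + z)) (g z) (h (1# + z)) (h z)

  private
    shift-inside : ∀ j (g h : ℝ → ℝ) x n →
      sumTo n (λ s → Δ g (shift s x) * h (shift (suc j) (shift s x)))
        ≡ sumTo n (λ s → Δ g (shift s x) * (h ∘ shift j) (shift (suc s) x))
    shift-inside j g h x n = sumTo-cong n λ s _ → cong (λ w → Δ g (shift s x) * h w) (sym (shift-1+ j (shift s x)))

  Δ^-orthogonal : ∀ n j (g h : ℝ → ℝ) x → DegreeBelow j h →
    (∀ i → i ℕ.< j → Δ^ i g x ≡ 0#) → (∀ i → i ℕ.< j → Δ^ i g (shift (suc n) x) ≡ 0#) →
    sumTo n (λ s → Δ^ j g (shift s x) * h (shift j (shift s x))) ≡ 0#
  Δ^-orthogonal n zero g h x dh _ _ = sumTo-0 n _ λ s → trans (cong (g (shift s x) *_) (Δ^≡0 dh _)) (zeroʳ _)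
  Δ^-orthogonal n (suc j) g h x dh Δ^g≡0 Δ^g′≡0 = begin
    sumTo n (λ s → Δ (Δ^ j g) (shift s x) * h (shift (suc j) (shift s x)))
      ≡⟨ shift-inside j (Δ^ j g) h x n ⟩
    sumTo n (λ s → Δ (Δ^ j g) (shift s x) * hⱼ (shift (suc s) x))
      ≡⟨ summation-by-parts n (Δ^ j g) hⱼ x ⟩
    Δ^ j g (shift (suc n) x) * hⱼ (shift (suc n) x) − Δ^ j g x * hⱼ x − sumTo n (λ s → Δ^ j g (shift s x) * Δ hⱼ (shift s x))
      ≡⟨ cong₂ (λ a b → a * hⱼ (shift (suc n) x) − b * hⱼ x − sumTo n (λ s → Δ^ j g (shift s x) * Δ hⱼ (shift s x)))
               (Δ^g′≡0 j ℕP.≤-refl) (Δ^g≡0 j ℕP.≤-refl) ⟩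
    0# * hⱼ (shift (suc n) x) − 0# * hⱼ x − sumTo n (λ s → Δ^ j g (shift s x) * Δ hⱼ (shift s x))
      ≡⟨ cong (0# * hⱼ (shift (suc n) x) − 0# * hⱼ x −_) inner ⟩
    0# * hⱼ (shift (suc n) x) − 0# * hⱼ x − 0#
      ≡⟨ solve 2 (λ a b → con (+ 0) :* a :- con (+ 0) :* b :- con (+ 0) := con (+ 0)) refl _ _ ⟩
    0# ∎
    where
    open ≡-Reasoning
    hⱼ : ℝ → ℝ
    hⱼ = h ∘ shift j
    inner : sumTo n (λ s → Δ^ j g (shift s x) * Δ hⱼ (shift s x)) ≡ 0#
    inner = trans (sumTo-cong n λ s _ → cong (Δ^ j g (shift s x) *_) (Δ-∘shift j h (shift s x)))
      (Δ^-orthogonal n j g (Δ h) x (DegreeBelow-Δ dh) (λ i i<j → Δ^g≡0 i (ℕP.m<n⇒m<1+n i<j))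
                                                      (λ i i<j → Δ^g′≡0 i (ℕP.m<n⇒m<1+n i<j)))

  Δ^-vanishing : ∀ i G y → (∀ r → r ℕ.≤ i → G (shift r y) ≡ 0#) → Δ^ i G y ≡ 0#
  Δ^-vanishing zero    G y G≡0 = G≡0 0 z≤n
  Δ^-vanishing (suc i) G y G≡0 = trans
    (cong₂ _−_ (Δ^-vanishing i G (1# + y) λ r r≤i → trans (cong G (shift-1+ r y)) (G≡0 (suc r) (s≤s r≤i)))
               (Δ^-vanishing i G y λ r r≤i → G≡0 r (ℕP.m≤n⇒m≤1+n r≤i)))
    (-‿inverseʳ 0#)

  Δ^-vanishing-below : ∀ i G y → (∀ r → r ℕ.< i → G (shift r y) ≡ 0#) → Δ^ i G y ≡ G (shift i y)
  Δ^-vanishing-below zero    G y _   = refl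
  Δ^-vanishing-below (suc i) G y G≡0 = trans
    (cong₂ _−_ (Δ^-vanishing-below i G (1# + y) λ r r<i → trans (cong G (shift-1+ r y)) (G≡0 (suc r) (s≤s r<i)))
               (Δ^-vanishing i G y λ r r≤i → G≡0 r (s≤s r≤i)))
    (trans (cong₂ _−_ (cong G (shift-1+ i y)) refl) (solve 1 (λ a → a :- con (+ 0) := a) refl _))

  sign : ℕ → ℝ
  sign zero    = 1#
  sign (suc k) = - sign k

  Δ^-vanishing-inside : ∀ k G y → (∀ r → 0 ℕ.< r → r ℕ.≤ k → G (shift r y) ≡ 0#) →
                        Δ^ (suc k) G y ≡ G (shift (suc k) y) + sign (suc k) * G y
  Δ^-vanishing-inside zero    G y _   = solve 2 (λ a b → a :- b := a :+ (:- con (+ 1)) :* b) refl _ _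
  Δ^-vanishing-inside (suc k) G y G≡0 = begin
    Δ^ (suc k) G (1# + y) − Δ^ (suc k) G y
      ≡⟨ cong₂ _−_ (Δ^-vanishing-below (suc k) G (1# + y) λ r r<1+k → trans (cong G (shift-1+ r y)) (G≡0 (suc r) (s≤s z≤n) r<1+k))
                   (Δ^-vanishing-inside k G y λ r 0<r r≤k → G≡0 r 0<r (ℕP.m≤n⇒m≤1+n r≤k)) ⟩
    G (shift (suc k) (1# + y)) − (G (shift (suc k) y) + sign (suc k) * G y)
      ≡⟨ cong₂ (λ a b → G a − (b + sign (suc k) * G y)) (shift-1+ (suc k) y) (G≡0 (suc k) (s≤s z≤n) ℕP.≤-refl) ⟩
    G (shift (suc (suc k)) y) − (0# + sign (suc k) * G y)
      ≡⟨ solve 3 (λ a s g → a :- (con (+ 0) :+ s :* g) := a :+ (:- s) :* g) refl _ _ _ ⟩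
    G (shift (suc (suc k)) y) + sign (suc (suc k)) * G y ∎
    where open ≡-Reasoning

  reproducing-identity : ∀ n d (G f : ℝ → ℝ) x → DegreeBelow (suc d) f →
    (∀ r → r ℕ.< d → G (shift r x) ≡ 0#) → (∀ r → r ℕ.≤ d → G (shift r (shift (suc n) x)) ≡ 0#) →
    sumTo n (λ s → Δ^ (suc d) G (shift s x) * f (shift (suc d) (shift s x))) ≡ - (G (shift d x) * f (shift d x))
  reproducing-identity n d G f x df G≡0 G′≡0 = begin
    sumTo n (λ s → Δ (Δ^ d G) (shift s x) * f (shift (suc d) (shift s x)))
      ≡⟨ shift-inside d (Δ^ d G) f x n ⟩
    sumTo n (λ s → Δ (Δ^ d G) (shift s x) * f_d (shift (suc s) x))
      ≡⟨ summation-by-parts n (Δ^ d G) f_d x ⟩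
    Δ^ d G x′ * f_d x′ − Δ^ d G x * f_d x − sumTo n (λ s → Δ^ d G (shift s x) * Δ f_d (shift s x))
      ≡⟨ cong₂ (λ a b → a * f_d x′ − b * f_d x − sumTo n (λ s → Δ^ d G (shift s x) * Δ f_d (shift s x)))
               (Δ^-vanishing d G x′ G′≡0) (Δ^-vanishing-below d G x G≡0) ⟩
    0# * f_d x′ − G (shift d x) * f_d x − sumTo n (λ s → Δ^ d G (shift s x) * Δ f_d (shift s x))
      ≡⟨ cong (0# * f_d x′ − G (shift d x) * f_d x −_) inner ⟩
    0# * f_d x′ − G (shift d x) * f_d x − 0#
      ≡⟨ solve 2 (λ a b → con (+ 0) :* a :- b :- con (+ 0) := :- b) refl _ _ ⟩
    - (G (shift d x) * f (shift d x)) ∎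
    where
    open ≡-Reasoning
    x′ : ℝ
    x′ = shift (suc n) x
    f_d : ℝ → ℝ
    f_d = f ∘ shift d
    inner : sumTo n (λ s → Δ^ d G (shift s x) * Δ f_d (shift s x)) ≡ 0#
    inner = trans (sumTo-cong n λ s _ → cong (Δ^ d G (shift s x) *_) (Δ-∘shift d f (shift s x)))
      (Δ^-orthogonal n d G (Δ f) x (DegreeBelow-Δ df)
        (λ i i<d → Δ^-vanishing i G x λ r r≤i → G≡0 r (ℕP.≤-<-trans r≤i i<d))
        (λ i i<d → Δ^-vanishing i G x′ λ r r≤i → G′≡0 r (ℕP.≤-trans r≤i (ℕP.<⇒≤ i<d))))

  -- The kernel

  leftProduct : ℝ → ℕ → ℝ → ℝ
  leftProduct x zero    y = 1#
  leftProduct x (suc k) y = (y − shift k x) * leftProduct x k y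

  rightProduct : ℝ → ℕ → ℕ → ℝ → ℝ
  rightProduct x n zero    y = 1#
  rightProduct x n (suc k) y = rightProduct x n k y * (shift (n ℕ.+ suc k) x − y)

  DegreeBelow-leftProduct : ∀ x k → DegreeBelow (suc k) (leftProduct x k)
  DegreeBelow-leftProduct x zero    = DegreeBelow-const 0 1#
  DegreeBelow-leftProduct x (suc k) = DegreeBelow-linear* (shift k x) (DegreeBelow-leftProduct x k)

  DegreeBelow-left*right : ∀ x d n k → DegreeBelow (k ℕ.+ suc d) (λ y → leftProduct x d y * rightProduct x n k y)
  DegreeBelow-left*right x d n zero    = DegreeBelow-cong (λ y → sym (*-identityʳ _)) (DegreeBelow-leftProduct x d)
  DegreeBelow-left*right x d n (suc k) = DegreeBelow-cong
    (λ y → solve 4 (λ y r a b → (:- con (+ 1)) :* ((y :- r) :* (a :* b)) := a :* (b :* (r :- y))) refl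
             y (shift (n ℕ.+ suc k) x) (leftProduct x d y) (rightProduct x n k y))
    (DegreeBelow-* (- 1#) (DegreeBelow-linear* (shift (n ℕ.+ suc k) x) (DegreeBelow-left*right x d n k)))

  leftProduct-root : ∀ x {k r} → r ℕ.< k → leftProduct x k (shift r x) ≡ 0#
  leftProduct-root x {suc k} {r} r<1+k with ℕP.m<1+n⇒m<n∨m≡n r<1+k
  ... | inj₁ r<k  = trans (cong ((shift r x − shift k x) *_) (leftProduct-root x r<k)) (zeroʳ _)
  ... | inj₂ refl = trans (cong (_* leftProduct x k (shift r x)) (-‿inverseʳ _)) (zeroˡ _)

  rightProduct-root : ∀ x n {k j} → 1 ℕ.≤ j → j ℕ.≤ k → rightProduct x n k (shift (n ℕ.+ j) x) ≡ 0#
  rightProduct-root x n {zero}  {suc j} _ ()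
  rightProduct-root x n {suc k} {j} 1≤j j≤1+k with ℕP.m≤n⇒m<n∨m≡n j≤1+k
  ... | inj₁ j<1+k = trans (cong (_* (shift (n ℕ.+ suc k) x − shift (n ℕ.+ j) x)) (rightProduct-root x n 1≤j (ℕP.≤-pred j<1+k)))
                           (zeroˡ _)
  ... | inj₂ refl  = trans (cong (rightProduct x n k (shift (n ℕ.+ j) x) *_) (-‿inverseʳ _)) (zeroʳ _)

  private
    shift-difference : ∀ a b x → shift (a ℕ.+ b) x − shift b x ≡ fromℕ a
    shift-difference a b x = begin
      shift (a ℕ.+ b) x − shift b x         ≡⟨ cong₂ _−_ (shift≡fromℕ+ (a ℕ.+ b) x) (shift≡fromℕ+ b x) ⟩
      fromℕ (a ℕ.+ b) + x − (fromℕ b + x)   ≡⟨ cong (λ z → z + x − (fromℕ b + x)) (fromℕ-+ a b) ⟩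
      fromℕ a + fromℕ b + x − (fromℕ b + x) ≡⟨ solve 3 (λ a b x → a :+ b :+ x :- (b :+ x) := a) refl (fromℕ a) (fromℕ b) x ⟩
      fromℕ a                               ∎
      where open ≡-Reasoning

  leftProduct-at : ∀ x {d} k → k ℕ.≤ d → leftProduct x k (shift d x) ≡ fromℕ (d P′ k)
  leftProduct-at x         zero    _   = sym (+-identityʳ 1#)
  leftProduct-at x {d} (suc k) k<d = begin
    (shift d x − shift k x) * leftProduct x k (shift d x)
      ≡⟨ cong₂ _*_ (trans (cong (λ j → shift j x − shift k x) (sym (ℕP.m∸n+n≡m k≤d))) (shift-difference (d ∸ k) k x))
                   (leftProduct-at x k k≤d) ⟩
    fromℕ (d ∸ k) * fromℕ (d P′ k)
      ≡⟨ fromℕ-* (d ∸ k) (d P′ k) ⟨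
    fromℕ (d P′ suc k) ∎
    where
    open ≡-Reasoning
    k≤d : k ℕ.≤ d
    k≤d = ℕP.<⇒≤ k<d

  leftProduct-before : ∀ x k → leftProduct x k (- 1# + x) ≡ sign k * fromℕ (k !)
  leftProduct-before x zero    = sym (trans (*-identityˡ _) (+-identityʳ 1#))
  leftProduct-before x (suc k) = begin
    (- 1# + x − shift k x) * leftProduct x k (- 1# + x)
      ≡⟨ cong₂ (λ a b → (- 1# + x − a) * b) (shift≡fromℕ+ k x) (leftProduct-before x k) ⟩
    (- 1# + x − (fromℕ k + x)) * (sign k * fromℕ (k !))
      ≡⟨ solve 4 (λ k s f x → (:- con (+ 1) :+ x :- (k :+ x)) :* (s :* f) := (:- s) :* ((con (+ 1) :+ k) :* f))
               refl (fromℕ k) (sign k) (fromℕ (k !)) x ⟩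
    - sign k * (fromℕ (suc k) * fromℕ (k !))
      ≡⟨ cong (- sign k *_) (fromℕ-* (suc k) (k !)) ⟨
    - sign k * fromℕ (suc k !) ∎
    where open ≡-Reasoning

  rightProduct-at : ∀ x D d k → rightProduct x (D ℕ.+ d) k (shift d x) ≡ fromℕ (rising D k)
  rightProduct-at x D d zero    = sym (+-identityʳ 1#)
  rightProduct-at x D d (suc k) = begin
    rightProduct x (D ℕ.+ d) k (shift d x) * (shift (D ℕ.+ d ℕ.+ suc k) x − shift d x)
      ≡⟨ cong₂ _*_ (rightProduct-at x D d k)
                   (trans (cong (λ j → shift j x − shift d x) (reorder D d (suc k))) (shift-difference (D ℕ.+ suc k) d x)) ⟩
    fromℕ (rising D k) * fromℕ (D ℕ.+ suc k)
      ≡⟨ fromℕ-* (rising D k) (D ℕ.+ suc k) ⟨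
    fromℕ (rising D (suc k)) ∎
    where
    open ≡-Reasoning
    reorder : ∀ D d j → D ℕ.+ d ℕ.+ j ≡ D ℕ.+ j ℕ.+ d
    reorder = solve-∀

  rightProduct-before : ∀ x n k → rightProduct x n k (- 1# + x) ≡ fromℕ (rising (suc n) k)
  rightProduct-before x n zero    = sym (+-identityʳ 1#)
  rightProduct-before x n (suc k) = begin
    rightProduct x n k (- 1# + x) * (shift (n ℕ.+ suc k) x − (- 1# + x))
      ≡⟨ cong₂ (λ a b → a * (b − (- 1# + x))) (rightProduct-before x n k) (shift≡fromℕ+ (n ℕ.+ suc k) x) ⟩
    fromℕ (rising (suc n) k) * (fromℕ (n ℕ.+ suc k) + x − (- 1# + x))
      ≡⟨ cong (fromℕ (rising (suc n) k) *_) (solve 2 (λ a x → a :+ x :- (:- con (+ 1) :+ x) := con (+ 1) :+ a) refl _ x) ⟩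
    fromℕ (rising (suc n) k) * fromℕ (suc n ℕ.+ suc k)
      ≡⟨ fromℕ-* (rising (suc n) k) (suc n ℕ.+ suc k) ⟨
    fromℕ (rising (suc n) (suc k)) ∎
    where open ≡-Reasoning

  sign*sign : ∀ k → sign k * sign k ≡ 1#
  sign*sign zero    = *-identityˡ 1#
  sign*sign (suc k) = trans (solve 1 (λ s → (:- s) :* (:- s) := s :* s) refl (sign k)) (sign*sign k)

  module Kernel (x : ℝ) (d D : ℕ) where
    n m : ℕ
    n = D ℕ.+ d
    m = suc d

    t x₋₁ : ℝ
    t = shift d x
    x₋₁ = - 1# + x

    G : ℝ → ℝ
    G y = leftProduct x d y * rightProduct x n m y

    W : ℝ → ℝ
    W = Δ^ m G

    G-root-left : ∀ r → r ℕ.< d → G (shift r x) ≡ 0#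
    G-root-left r r<d = trans (cong (_* rightProduct x n m (shift r x)) (leftProduct-root x r<d)) (zeroˡ _)

    G-root-right : ∀ r → r ℕ.≤ d → G (shift r (shift (suc n) x)) ≡ 0#
    G-root-right r r≤d = begin
      G (shift r (shift (suc n) x))
        ≡⟨ cong G (trans (shift-shift r (suc n) x) (cong (λ j → shift j x) (reorder r n))) ⟩
      G (shift (n ℕ.+ suc r) x)
        ≡⟨ cong (leftProduct x d (shift (n ℕ.+ suc r) x) *_) (rightProduct-root x n (s≤s z≤n) (s≤s r≤d)) ⟩
      leftProduct x d _ * 0#
        ≡⟨ zeroʳ _ ⟩
      0# ∎
      where
      open ≡-Reasoning
      reorder : ∀ r n → r ℕ.+ suc n ≡ n ℕ.+ suc r
      reorder = solve-∀

    G-at-t : G t ≡ fromℕ (d !) * fromℕ (rising D m)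
    G-at-t = cong₂ _*_ (trans (leftProduct-at x d ℕP.≤-refl) (cong fromℕ (nP′n≡n! d))) (rightProduct-at x D d m)

    G-before : G x₋₁ ≡ sign d * fromℕ (d !) * fromℕ (rising (suc n) m)
    G-before = cong₂ _*_ (leftProduct-before x d) (rightProduct-before x n m)

    W-before : W x₋₁ ≡ fromℕ (d !) * fromℕ (rising D m) − fromℕ (d !) * fromℕ (rising (suc n) m)
    W-before = begin
      W x₋₁                                         ≡⟨ Δ^-vanishing-inside d G x₋₁ G-root-inside ⟩
      G (shift m x₋₁) + sign m * G x₋₁              ≡⟨ cong₂ (λ a b → G a + sign m * b) (shift-from-x₋₁ d) G-before ⟩
      G t + - sign d * (sign d * α * P)             ≡⟨ cong (λ a → a + - sign d * (sign d * α * P)) G-at-t ⟩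
      α * Q + - sign d * (sign d * α * P)
        ≡⟨ solve 4 (λ s a q p → a :* q :+ (:- s) :* (s :* a :* p) := a :* q :- (s :* s) :* (a :* p)) refl (sign d) α Q P ⟩
      α * Q − sign d * sign d * (α * P)             ≡⟨ cong (λ z → α * Q − z * (α * P)) (sign*sign d) ⟩
      α * Q − 1# * (α * P)                          ≡⟨ cong (α * Q −_) (*-identityˡ _) ⟩
      α * Q − α * P                                 ∎
      where
      open ≡-Reasoning
      α Q P : ℝ
      α = fromℕ (d !)
      Q = fromℕ (rising D m)
      P = fromℕ (rising (suc n) m)
      shift-from-x₋₁ : ∀ r → shift (suc r) x₋₁ ≡ shift r x
      shift-from-x₋₁ r = trans (sym (shift-1+ r x₋₁)) (cong (shift r) (solve 1 (λ x → con (+ 1) :+ (:- con (+ 1) :+ x) := x) refl x))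
      G-root-inside : ∀ r → 0 ℕ.< r → r ℕ.≤ d → G (shift r x₋₁) ≡ 0#
      G-root-inside (suc r) _ r<d = trans (cong G (shift-from-x₋₁ r)) (G-root-left r r<d)

    DegreeBelow-W : DegreeBelow m W
    DegreeBelow-W = DegreeBelow-Δ^ m (DegreeBelow-left*right x d n m)

    W-reproduces : ∀ f → DegreeBelow m f → sumTo n (λ s → W (shift s x) * f (shift m (shift s x))) ≡ - (G t * f t)
    W-reproduces f df = reproducing-identity n d G f x df G-root-left G-root-right

    W-norm : sumTo n (λ s → W (shift s x) * W (shift s x)) ≡ - (G t * W x₋₁)
    W-norm = begin
      sumTo n (λ s → W (shift s x) * W (shift s x))
        ≡⟨ sumTo-cong n (λ s _ → cong (W (shift s x) *_) (sym (W-back (shift s x)))) ⟩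
      sumTo n (λ s → W (shift s x) * W′ (shift m (shift s x)))
        ≡⟨ W-reproduces W′ (DegreeBelow-translate (- fromℕ m) DegreeBelow-W) ⟩
      - (G t * W′ t)
        ≡⟨ cong (λ z → - (G t * W z)) W′-at-t ⟩
      - (G t * W x₋₁) ∎
      where
      open ≡-Reasoning
      W′ : ℝ → ℝ
      W′ y = W (- fromℕ m + y)
      W-back : ∀ y → W′ (shift m y) ≡ W y
      W-back y = cong W (trans (cong (_+_ (- fromℕ m)) (shift≡fromℕ+ m y)) (solve 2 (λ a y → :- a :+ (a :+ y) := y) refl (fromℕ m) y))
      W′-at-t : - fromℕ m + t ≡ x₋₁
      W′-at-t = trans (cong (_+_ (- fromℕ m)) (shift≡fromℕ+ d x))
                      (solve 2 (λ a x → :- (con (+ 1) :+ a) :+ (a :+ x) := :- con (+ 1) :+ x) refl (fromℕ d) x)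

  sum-of-squares-expansion : ∀ n (F W : ℕ → ℝ) a b →
    sumTo n (λ s → (a * F s − b * W s) * (a * F s − b * W s))
      ≡ a * a * sumTo n (λ s → F s * F s) + - (a * b + a * b) * sumTo n (λ s → W s * F s) + b * b * sumTo n (λ s → W s * W s)
  sum-of-squares-expansion n F W a b = begin
    sumTo n (λ s → (a * F s − b * W s) * (a * F s − b * W s))
      ≡⟨ sumTo-cong n (λ s _ → solve 4 (λ a b f w → (a :* f :- b :* w) :* (a :* f :- b :* w)
                                       := a :* a :* (f :* f) :+ (:- (a :* b :+ a :* b)) :* (w :* f) :+ b :* b :* (w :* w))
                                     refl a b (F s) (W s)) ⟩
    sumTo n (λ s → a * a * (F s * F s) + c * (W s * F s) + b * b * (W s * W s))
      ≡⟨ trans (sumTo-+ n _ _) (cong (_+ _) (sumTo-+ n _ _)) ⟩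
    sumTo n (λ s → a * a * (F s * F s)) + sumTo n (λ s → c * (W s * F s)) + sumTo n (λ s → b * b * (W s * W s))
      ≡⟨ cong₂ _+_ (cong₂ _+_ (sumTo-* n (a * a) _) (sumTo-* n c _)) (sumTo-* n (b * b) _) ⟩
    a * a * sumTo n (λ s → F s * F s) + c * sumTo n (λ s → W s * F s) + b * b * sumTo n (λ s → W s * W s) ∎
    where
    open ≡-Reasoning
    c : ℝ
    c = - (a * b + a * b)

  -- Cauchy–Schwarz for F and W, in the form 0 ≤ Σ (W(x₋₁) F − f(t) W)².
  kernel-bound : ∀ f d D x → DegreeBelow (suc d) f →
    fromℕ (rising D (suc d)) * (f (shift d x) * f (shift d x))
      ≤ fromℕ (rising (suc (D ℕ.+ d)) (suc d) ∸ rising D (suc d))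
        * sumTo (D ℕ.+ d) (λ s → f (shift (suc s) (shift d x)) * f (shift (suc s) (shift d x)))
  kernel-bound f d D x df = ≤-resp-≡ refl (cong (fromℕ u *_) (sumTo-cong n λ s _ → cong (λ y → f y * f y) (window-point s)))
    (0≤y−x⇒x≤y (fromℕ-*-cancelˡ-≤ N N-pos (≤-resp-≡ (sym (zeroʳ _)) key (sumTo-nonneg n _ λ s → 0≤x*x _))))
    where
    open Kernel x d D
    Q P u N : ℕ
    Q = rising D m
    P = rising (suc n) m
    u = P ∸ Q
    N = d ! ℕ.* d ! ℕ.* u
    F Ws : ℕ → ℝ
    F s = f (shift m (shift s x))
    Ws s = W (shift s x)
    α B φ δ : ℝ
    α = fromℕ (d !)
    B = sumTo n (λ s → F s * F s)
    φ = f t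
    δ = W x₋₁
    window-point : ∀ s → shift m (shift s x) ≡ shift (suc s) t
    window-point s = trans (shift-shift m s x) (trans (cong (λ j → shift (suc j) x) (ℕP.+-comm d s)) (sym (shift-shift (suc s) d x)))
    Q<P : Q ℕ.< P
    Q<P = rising-mono-< d (s≤s (ℕP.m≤m+n D d))
    N-pos : 0 ℕ.< N
    N-pos = ℕP.*-mono-< (ℕP.*-mono-< (ℕP.1≤n! d) (ℕP.1≤n! d)) (ℕP.m<n⇒0<n∸m Q<P)
    δ-value : δ ≡ α * fromℕ Q − α * (fromℕ Q + fromℕ u)
    δ-value = trans W-before (cong (λ p → α * fromℕ Q − α * p)
      (trans (cong fromℕ (sym (ℕP.m+[n∸m]≡n (ℕP.<⇒≤ Q<P)))) (fromℕ-+ Q u)))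
    key : sumTo n (λ s → (δ * F s − φ * Ws s) * (δ * F s − φ * Ws s)) ≡ fromℕ N * (fromℕ u * B − fromℕ Q * (φ * φ))
    key = begin
      sumTo n (λ s → (δ * F s − φ * Ws s) * (δ * F s − φ * Ws s))
        ≡⟨ sum-of-squares-expansion n F Ws δ φ ⟩
      δ * δ * B + - (δ * φ + δ * φ) * sumTo n (λ s → Ws s * F s) + φ * φ * sumTo n (λ s → Ws s * Ws s)
        ≡⟨ cong₂ (λ a b → δ * δ * B + - (δ * φ + δ * φ) * a + φ * φ * b) (W-reproduces f df) W-norm ⟩
      δ * δ * B + - (δ * φ + δ * φ) * - (G t * φ) + φ * φ * - (G t * δ)
        ≡⟨ cong₂ (λ g e → e * e * B + - (e * φ + e * φ) * - (g * φ) + φ * φ * - (g * e)) G-at-t δ-value ⟩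
      _ ≡⟨ solve 5 (λ a q v b φ → let e = a :* q :- a :* (q :+ v) in
               e :* e :* b :+ (:- (e :* φ :+ e :* φ)) :* (:- ((a :* q) :* φ)) :+ φ :* φ :* (:- ((a :* q) :* e))
                 := (a :* a :* v) :* (v :* b :- q :* (φ :* φ))) refl α (fromℕ Q) (fromℕ u) B φ ⟩
      α * α * fromℕ u * (fromℕ u * B − fromℕ Q * (φ * φ))
        ≡⟨ cong (_* (fromℕ u * B − fromℕ Q * (φ * φ)))
                (trans (fromℕ-* (d ! ℕ.* d !) u) (cong (_* fromℕ u) (fromℕ-* (d !) (d !)))) ⟨
      fromℕ N * (fromℕ u * B − fromℕ Q * (φ * φ)) ∎
      where open ≡-Reasoning

  kernel-window-bound : ∀ f d D K L τ → DegreeBelow (suc d) f →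
    (rising (suc (D ℕ.+ d)) (suc d) ∸ rising D (suc d)) ℕ.* L ℕ.≤ K ℕ.* rising D (suc d) →
    fromℕ L * (f τ * f τ) ≤ fromℕ K * sumTo (D ℕ.+ d) (λ s → f (shift (suc s) τ) * f (shift (suc s) τ))
  kernel-window-bound f d D K L τ df gap = fromℕ-*-cancelˡ-≤ Q (rising-pos D (suc d)) (begin
    fromℕ Q * (fromℕ L * φ²) ≡⟨ solve 3 (λ q l p → q :* (l :* p) := l :* (q :* p)) refl (fromℕ Q) (fromℕ L) φ² ⟩
    fromℕ L * (fromℕ Q * φ²) ≤⟨ *-monoˡ-≤ (fromℕ L) (0≤fromℕ L) (subst Kernel-bound t≡τ (kernel-bound f d D x df)) ⟩
    fromℕ L * (fromℕ u * B)  ≡⟨ trans (solve 3 (λ l u b → l :* (u :* b) := u :* l :* b) refl (fromℕ L) (fromℕ u) B)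
                                      (cong (_* B) (sym (fromℕ-* u L))) ⟩
    fromℕ (u ℕ.* L) * B      ≤⟨ *-monoʳ-≤ B (sumTo-nonneg (D ℕ.+ d) _ λ s → 0≤x*x _) (fromℕ-mono-≤ gap) ⟩
    fromℕ (K ℕ.* Q) * B      ≡⟨ trans (cong (_* B) (fromℕ-* K Q))
                                      (solve 3 (λ k q b → k :* q :* b := q :* (k :* b)) refl (fromℕ K) (fromℕ Q) B) ⟩
    fromℕ Q * (fromℕ K * B)  ∎)
    where
    open ≤-Reasoning
    Q u : ℕ
    Q = rising D (suc d)
    u = rising (suc (D ℕ.+ d)) (suc d) ∸ Q
    φ² B x : ℝ
    φ² = f τ * f τ
    B = sumTo (D ℕ.+ d) (λ s → f (shift (suc s) τ) * f (shift (suc s) τ))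
    x = - fromℕ d + τ
    t≡τ : shift d x ≡ τ
    t≡τ = trans (shift≡fromℕ+ d x) (solve 2 (λ e τ → e :+ (:- e :+ τ) := τ) refl (fromℕ d) τ)
    Kernel-bound : ℝ → Set
    Kernel-bound t = fromℕ Q * (f t * f t) ≤ fromℕ u * sumTo (D ℕ.+ d) (λ s → f (shift (suc s) t) * f (shift (suc s) t))

  window-bound : ∀ f d n L τ → DegreeBelow (suc d) f → 1 ℕ.≤ d → 100 ℕ.* d ℕ.* d ℕ.≤ L → L ℕ.≤ 2 ℕ.* suc n →
    fromℕ L * (f τ * f τ) ≤ fromℕ (100 ℕ.* d ℕ.* d) * sumTo n (λ s → f (shift (suc s) τ) * f (shift (suc s) τ))
  window-bound f d n L τ df 1≤d K≤L L≤2M =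
    subst (λ k → fromℕ L * (f τ * f τ) ≤ fromℕ K * sumTo k (λ s → f (shift (suc s) τ) * f (shift (suc s) τ))) D+d≡n
      (kernel-window-bound f d D K L τ df gap)
    where
    K : ℕ
    K = 100 ℕ.* d ℕ.* d
    D-and-gap : Σ ℕ λ D → D ℕ.+ d ≡ n × (rising (suc (D ℕ.+ d)) (suc d) ∸ rising D (suc d)) ℕ.* L ℕ.≤ K ℕ.* rising D (suc d)
    D-and-gap = window-gap-bound d n L 1≤d K≤L L≤2M
    D : ℕ
    D = proj₁ D-and-gap
    D+d≡n : D ℕ.+ d ≡ n
    D+d≡n = proj₁ (proj₂ D-and-gap)
    gap : (rising (suc (D ℕ.+ d)) (suc d) ∸ rising D (suc d)) ℕ.* L ℕ.≤ K ℕ.* rising D (suc d)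
    gap = proj₂ (proj₂ D-and-gap)

  right-point : ∀ a i s → shift (suc s) (fromℤ (a ℤ.+ + i)) ≡ fromℤ (a ℤ.+ + suc (i ℕ.+ s))
  right-point a i s = begin
    shift (suc s) (fromℤ (a ℤ.+ + i))
      ≡⟨ trans (shift≡fromℕ+ (suc s) _) (cong (_+_ (fromℕ (suc s))) (fromℤ-+ a (+ i))) ⟩
    (1# + fromℕ s) + (fromℤ a + fromℕ i)
      ≡⟨ solve 4 (λ o s a i → (o :+ s) :+ (a :+ i) := a :+ (o :+ (i :+ s))) refl 1# (fromℕ s) (fromℤ a) (fromℕ i) ⟩
    fromℤ a + (1# + (fromℕ i + fromℕ s))
      ≡⟨ trans (fromℤ-+ a (+ suc (i ℕ.+ s))) (cong (λ z → fromℤ a + (1# + z)) (fromℕ-+ i s)) ⟨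
    fromℤ (a ℤ.+ + suc (i ℕ.+ s)) ∎
    where open ≡-Reasoning

  left-point : ∀ a n s → s ℕ.≤ n → - shift (suc s) (- fromℤ (a ℤ.+ + suc n)) ≡ fromℤ (a ℤ.+ + (n ∸ s))
  left-point a n s s≤n = begin
    - shift (suc s) (- fromℤ (a ℤ.+ + suc n))
      ≡⟨ cong -_ (trans (shift≡fromℕ+ (suc s) _) (cong (λ z → fromℕ (suc s) + - z) (fromℤ-+ a (+ suc n)))) ⟩
    - ((1# + fromℕ s) + - (fromℤ a + (1# + fromℕ n)))
      ≡⟨ solve 4 (λ o s a n → :- ((o :+ s) :+ :- (a :+ (o :+ n))) := a :+ (n :- s)) refl 1# (fromℕ s) (fromℤ a) (fromℕ n) ⟩
    fromℤ a + (fromℕ n − fromℕ s)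
      ≡⟨ trans (fromℤ-+ a (+ (n ∸ s))) (cong (_+_ (fromℤ a)) (fromℕ-∸ s≤n)) ⟨
    fromℤ (a ℤ.+ + (n ∸ s)) ∎
    where open ≡-Reasoning

  module _ (g : ℝ → ℝ) (0≤g : ∀ y → 0# ≤ g y) (a : ℤ) where
    right-window-≤ : ∀ {t i n L} → t ≡ a ℤ.+ + i → suc (i ℕ.+ n) ≡ L →
      sumTo n (λ s → g (shift (suc s) (fromℤ t))) ≤ sumTo L (λ k → g (fromℤ (a ℤ.+ + k)))
    right-window-≤ {i = i} {n} refl refl = ≤-resp-≡ (sumTo-cong n λ s _ → cong g (sym (right-point a i s))) refl
      (sumTo-tail-≤ (λ k → g (fromℤ (a ℤ.+ + k))) (λ k → 0≤g _) i n)

    left-window-≤ : ∀ {t i n L} → t ≡ a ℤ.+ + i → suc n ≡ i → i ℕ.≤ L →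
      sumTo n (λ s → g (- shift (suc s) (- fromℤ t))) ≤ sumTo L (λ k → g (fromℤ (a ℤ.+ + k)))
    left-window-≤ {n = n} refl refl i≤L = ≤-resp-≡
      (trans (sym (sumTo-reverse n _)) (sumTo-cong n λ s s≤n → cong g (sym (left-point a n s s≤n)))) refl
      (sumTo-mono-upper (λ k → g (fromℤ (a ℤ.+ + k))) (λ k → 0≤g _) (ℕP.<⇒≤ i≤L))

  window-bound-reflected : ∀ f d n L τ → DegreeBelow (suc d) f → 1 ℕ.≤ d → 100 ℕ.* d ℕ.* d ℕ.≤ L → L ℕ.≤ 2 ℕ.* suc n →
    fromℕ L * (f τ * f τ) ≤ fromℕ (100 ℕ.* d ℕ.* d) * sumTo n (λ s → f (- shift (suc s) (- τ)) * f (- shift (suc s) (- τ)))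
  window-bound-reflected f d n L τ df 1≤d K≤L L≤2M =
    ≤-resp-≡ (cong (λ y → fromℕ L * (f y * f y)) (-‿involutive τ)) refl
      (window-bound (f ∘ -_) d n L (- τ) (DegreeBelow-reflect (suc d) df) 1≤d K≤L L≤2M)

lemma6p4 : (R : RealField) → let open RealField R in
  (d : ℕ) → 1 ℕ.≤ d →
  (c : Vec ℝ (suc d)) → ¬ (lead c ≡ 0#) →
  (a b : ℤ) → a ℤ.≤ b →
  100 ℕ.* d ℕ.* d ℕ.≤ ℤ.∣ b ℤ.- a ∣ →
  (t : ℤ) → a ℤ.≤ t → t ℤ.≤ b →
  eval c (fromℤ t) * eval c (fromℤ t)
    ≤ fromℕ (100 ℕ.* d ℕ.* d)
      * sumTo ℤ.∣ b ℤ.- a ∣ (λ k → eval c (fromℤ (a ℤ.+ + k)) * eval c (fromℤ (a ℤ.+ + k)))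
      * (fromℕ ℤ.∣ b ℤ.- a ∣) ⁻¹
-- Every polynomial of degree ≤ d satisfies the bound, so the leading coefficient is not used.
lemma6p4 R d 1≤d c _ a b _ K≤L t a≤t t≤b = ≤-*-fromℕ⁻¹ L 0<L (bound (longer-side i≤L 0<L))
  where
  open RealField R
  open Real R
  open RisingFactorials using (4[1+d]²+4[1+d]≤100d²)
  open IntegerInterval
  L i K : ℕ
  L = ℤ.∣ b ℤ.- a ∣
  i = ℤ.∣ t ℤ.- a ∣
  K = 100 ℕ.* d ℕ.* d
  i≤L : i ℕ.≤ L
  i≤L = offset-mono a≤t t≤b
  0<L : 0 ℕ.< L
  0<L = ℕP.<-≤-trans (s≤s z≤n) (ℕP.≤-trans (4[1+d]²+4[1+d]≤100d² d 1≤d) K≤L)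
  p² : ℝ → ℝ
  p² y = eval c y * eval c y
  K*-mono : ∀ {x y} → x ≤ y → fromℕ K * x ≤ fromℕ K * y
  K*-mono = *-monoˡ-≤ (fromℕ K) (0≤fromℕ K)
  bound : (Σ ℕ λ n → suc (i ℕ.+ n) ≡ L × L ℕ.≤ 2 ℕ.* suc n) ⊎ (Σ ℕ λ n → suc n ≡ i × L ℕ.≤ 2 ℕ.* suc n) →
          fromℕ L * p² (fromℤ t) ≤ fromℕ K * sumTo L (λ k → p² (fromℤ (a ℤ.+ + k)))
  bound (inj₁ (n , 1+i+n≡L , L≤2M)) = ≤-trans (window-bound (eval c) d n L (fromℤ t) (DegreeBelow-eval c) 1≤d K≤L L≤2M)
    (K*-mono (right-window-≤ p² (λ y → 0≤x*x _) a (offset a≤t) 1+i+n≡L))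
  bound (inj₂ (n , 1+n≡i , L≤2M)) = ≤-trans (window-bound-reflected (eval c) d n L (fromℤ t) (DegreeBelow-eval c) 1≤d K≤L L≤2M)
    (K*-mono (left-window-≤ p² (λ y → 0≤x*x _) a (offset a≤t) 1+n≡i i≤L))
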